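{- Let $G$ be a finite simple graph of class two with $\beta(G)\ge 2$. Then the girth of $G$ satisfies $g(G)\le 4$.
   Context: The girth $g(G)$ is the length of a shortest cycle in $G$ (infinite if $G$ is acyclic). $\beta(G)$ is the size of a minimum vertex cover. Alcuin problem: the vertices of $G$ are items initially on the left bank of a river; a man with a boat of capacity $b$ (a positive integer) must carry them all to the right bank so that no two adjacent vertices are ever left together on a bank. Formally, a feasible schedule for capacity $b$ is a sequence of triples $(L_k,B_k,R_k)$, $k=1,\dots,s$, $s$ odd, such that: each triple is a partition of $V$; $L_k$ and $R_k$ are independent sets; $|B_k|\le b$; $L_1\cup B_1=V$; $B_s\cup R_s=V$; for even $k$, $L_k=L_{k-1}$ and $B_k\cup R_k=B_{k-1}\cup R_{k-1}$; for odd $k\ge 3$, $R_k=R_{k-1}$ and $B_k\cup L_k=B_{k-1}\cup L_{k-1}$. The Alcuin number $c(G)$ is the least positive integer $b$ for which a feasible schedule exists. One always has $\beta(G)\le c(G)\le \beta(G)+1$; $G$ is of class one if $c(G)=\beta(G)$ and of class two if $c(G)=\beta(G)+1$. -}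

module Defs where

open import Data.Nat using (ℕ; zero; suc; _+_; _*_; _≤_; _<_)
open import Data.Bool using (Bool; true; false)
open import Data.Fin using (Fin; toℕ)
open import Data.Fin.Subset using (Subset; _∈_; ∣_∣)
open import Data.Vec using (tabulate)
open import Data.Product using (Σ; ∃; _×_; _,_)
open import Data.Sum using (_⊎_)
open import Relation.Nullary using (¬_)
open import Relation.Binary.PropositionalEquality using (_≡_; _≢_)
open import Function.Definitions using (Injective)

record Graph : Set where
  field
    n     : ℕ
    adj   : Fin n → Fin n → Bool
    sym   : ∀ u v → adj u v ≡ adj v u
    irrefl : ∀ v → adj v v ≡ false
open Graph public

IsVertexCover : (G : Graph) → Subset (n G) → Set
IsVertexCover G C = ∀ u v → adj G u v ≡ true → (u ∈ C) ⊎ (v ∈ C)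

IsVertexCoverNumber : Graph → ℕ → Set
IsVertexCoverNumber G β =
  (Σ (Subset (n G)) λ C → IsVertexCover G C × ∣ C ∣ ≡ β)
  × (∀ C → IsVertexCover G C → β ≤ ∣ C ∣)

next : ∀ {k} → Fin k → ℕ
next i = suc (toℕ i)

HasCycleOfLength : (G : Graph) → ℕ → Set
HasCycleOfLength G k =
  3 ≤ k ×
  (Σ (Fin k → Fin (n G)) λ c → Injective _≡_ _≡_ c ×
     (∀ i j → (toℕ j ≡ suc (toℕ i) ⊎ (toℕ j ≡ 0 × suc (toℕ i) ≡ k)) →
        adj G (c i) (c j) ≡ true))

-- g(G) ≤ m  (girth is infinite for acyclic graphs, so this requires a cycle)
GirthAtMost : Graph → ℕ → Set
GirthAtMost G m = ∃ λ k → k ≤ m × HasCycleOfLength G k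

-- Alcuin problem.  Each triple (L_k, B_k, R_k) partitioning V is encoded
-- as a map V → Side.
data Side : Set where
  L B R : Side

Config : Graph → Set
Config G = Fin (n G) → Side

inSide : Side → Side → Bool
inSide L L = true
inSide B B = true
inSide R R = true
inSide _ _ = false

part : (G : Graph) → Config G → Side → Subset (n G)
part G σ s = tabulate λ v → inSide s (σ v)

IndependentSide : (G : Graph) → Config G → Side → Set
IndependentSide G σ s = ∀ u v → σ u ≡ s → σ v ≡ s → adj G u v ≡ false

-- A feasible schedule for capacity b with s = 2m+1 triples; the triple
-- with (1-based) index k is  sch (k-1).
FeasibleSchedule : (G : Graph) → ℕ → (m : ℕ) → (ℕ → Config G) → Set
FeasibleSchedule G b m sch =
  (∀ i → i < suc (2 * m) →
     IndependentSide G (sch i) L × IndependentSide G (sch i) R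
     × ∣ part G (sch i) B ∣ ≤ b)
  × (∀ v → sch 0 v ≢ R)
  × (∀ v → sch (2 * m) v ≢ L)
  -- even k = 2j+2 (index 2j+1): L_k = L_{k-1} (so B_k ∪ R_k = B_{k-1} ∪ R_{k-1})
  × (∀ j → j < m → ∀ v →
       (sch (suc (2 * j)) v ≡ L → sch (2 * j) v ≡ L)
       × (sch (2 * j) v ≡ L → sch (suc (2 * j)) v ≡ L))
  -- odd k = 2j+3 ≥ 3 (index 2j+2): R_k = R_{k-1} (so B_k ∪ L_k = B_{k-1} ∪ L_{k-1})
  × (∀ j → j < m → ∀ v →
       (sch (suc (suc (2 * j))) v ≡ R → sch (suc (2 * j)) v ≡ R)
       × (sch (suc (2 * j)) v ≡ R → sch (suc (suc (2 * j))) v ≡ R))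

Feasible : Graph → ℕ → Set
Feasible G b = ∃ λ m → ∃ λ sch → FeasibleSchedule G b m sch

IsAlcuinNumber : Graph → ℕ → Set
IsAlcuinNumber G c =
  1 ≤ c × Feasible G c × (∀ b → 1 ≤ b → Feasible G b → c ≤ b)

ClassTwo : Graph → Set
ClassTwo G = Σ ℕ λ β → IsVertexCoverNumber G β × IsAlcuinNumber G (suc β)

-- Take a minimum vertex cover C and two distinct x, y ∈ C.  Two distinct common
-- neighbours of x and y outside C close a 4-cycle.  Otherwise the boat can always
-- hold C with x or y exchanged for one vertex outside C: these vertices are
-- independent, so they cross one at a time, first the non-neighbours of x while x
-- waits on the right bank, then the neighbours of x while y waits on the left bank,
-- the only possible common neighbour going first.  So capacity β(G) suffices and
-- G is of class one.
module Submission where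

open import Defs hiding (sym)
open import Data.Bool using (Bool; true; false) renaming (_≟_ to _≟ᵇ_)
open import Data.Bool.Properties using (¬-not)
open import Data.Fin using (Fin; zero; suc; toℕ; _≟_)
open import Data.Fin.Properties using (toℕ-injective; toℕ<n; any?)
open import Data.Fin.Subset
  using (Subset; _∈_; _∉_; _⊆_; _-_; ∣_∣; inside; outside; Nonempty)
open import Data.Fin.Subset.Properties
  using (_∈?_; nonempty?; Empty-unique; ∣⊥∣≡0; p─⊥≡p; p─q⊆p; p⊆q⇒∣p∣≤∣q∣;
         x∈p⇒∣p-x∣<∣p∣; x∈p∧x≢y⇒x∈p-y)
open import Data.Nat
  using (ℕ; suc; _+_; _*_; _≤_; _<_; z≤n; s≤s; s≤s⁻¹; _≤?_; _<?_; ⌊_/2⌋; ⌈_/2⌉)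
open import Data.Nat.Properties
  using (≤-refl; ≤-trans; ≤-antisym; n≤1+n; m≤m+n; <⇒≤; <⇒≢; <⇒≱; ≮⇒≥; ≰⇒>; 1+n≰n;
         <-≤-trans; +-monoʳ-≤; +-identityʳ; +-cancelˡ-≡; suc-injective; m+1+n≢m;
         ⌊n/2⌋-mono; ⌊n/2⌋≤⌈n/2⌉; n≡⌊n+n/2⌋; n≡⌈n+n/2⌉; module ≤-Reasoning)
open import Data.Product using (∃; ∃₂; _×_; _,_; proj₁)
open import Data.Sum using (_⊎_; inj₁; inj₂; [_,_]′)
open import Data.Vec using (_∷_; []; there; lookup)
open import Data.Vec.Properties using ([]=⇒lookup; lookup∘tabulate)
open import Data.Vec.Relation.Unary.All using (_∷_; [])
open import Data.Vec.Relation.Unary.Unique.Propositional using (Unique; _∷_; [])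
open import Data.Vec.Relation.Unary.Unique.Propositional.Properties using (lookup-injective)
open import Function using (_∘_)
open import Function.Definitions using (Injective)
open import Relation.Nullary using (¬_; Dec; yes; no; ¬?; contradiction)
open import Relation.Nullary.Decidable using (_×-dec_; _⊎-dec_; decidable-stable)
open import Relation.Binary.PropositionalEquality
  using (_≡_; _≢_; refl; sym; trans; cong; subst)

x∉p-x : ∀ {n} (p : Subset n) (x : Fin n) → x ∉ p - x
x∉p-x (_ ∷ p) zero    ()
x∉p-x (_ ∷ p) (suc x) (there x∈p-x) = x∉p-x p x x∈p-x

∣p∣≤1+∣p-x∣ : ∀ {n} (p : Subset n) (x : Fin n) → ∣ p ∣ ≤ suc ∣ p - x ∣
∣p∣≤1+∣p-x∣ (inside  ∷ p) zero    = subst (λ q → suc ∣ p ∣ ≤ suc ∣ q ∣) (sym (p─⊥≡p p)) ≤-refl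
∣p∣≤1+∣p-x∣ (outside ∷ p) zero    = subst (λ q → ∣ p ∣ ≤ suc ∣ q ∣) (sym (p─⊥≡p p)) (n≤1+n _)
∣p∣≤1+∣p-x∣ (inside  ∷ p) (suc x) = s≤s (∣p∣≤1+∣p-x∣ p x)
∣p∣≤1+∣p-x∣ (outside ∷ p) (suc x) = ∣p∣≤1+∣p-x∣ p x

∣p∣≤∣q∣-by-exchange : ∀ {n} {p q : Subset n} {w z : Fin n} → z ∈ q →
                      (∀ {v} → v ∈ p → v ≢ w → v ∈ q × v ≢ z) → ∣ p ∣ ≤ ∣ q ∣
∣p∣≤∣q∣-by-exchange {p = p} {q} {w} {z} z∈q exchange = begin
  ∣ p ∣          ≤⟨ ∣p∣≤1+∣p-x∣ p w ⟩
  suc ∣ p - w ∣  ≤⟨ s≤s (p⊆q⇒∣p∣≤∣q∣ p-w⊆q-z) ⟩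
  suc ∣ q - z ∣  ≤⟨ x∈p⇒∣p-x∣<∣p∣ z∈q ⟩
  ∣ q ∣          ∎
  where
  open ≤-Reasoning
  p-w⊆q-z : p - w ⊆ q - z
  p-w⊆q-z v∈p-w with exchange (p─q⊆p p _ v∈p-w) (λ { refl → x∉p-x p w v∈p-w })
  ... | v∈q , v≢z = x∈p∧x≢y⇒x∈p-y v∈q v≢z

1≤∣p∣⇒nonempty : ∀ {n} (p : Subset n) → 1 ≤ ∣ p ∣ → Nonempty p
1≤∣p∣⇒nonempty {n} p 1≤∣p∣ with nonempty? p
... | yes nonempty = nonempty
... | no empty with subst (1 ≤_) (trans (cong ∣_∣ (Empty-unique empty)) (∣⊥∣≡0 n)) 1≤∣p∣
...   | ()

two-members : ∀ {n} (p : Subset n) → 2 ≤ ∣ p ∣ → ∃₂ λ x y → x ∈ p × y ∈ p × x ≢ y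
two-members p 2≤∣p∣ with 1≤∣p∣⇒nonempty p (≤-trans (s≤s z≤n) 2≤∣p∣)
... | x , x∈p with 1≤∣p∣⇒nonempty (p - x) (s≤s⁻¹ (≤-trans 2≤∣p∣ (∣p∣≤1+∣p-x∣ p x)))
...   | y , y∈p-x = x , y , x∈p , p─q⊆p p _ y∈p-x , λ { refl → x∉p-x p x y∈p-x }

adj-sym : (G : Graph) {u v : Fin (n G)} → adj G u v ≡ true → adj G v u ≡ true
adj-sym G {u} {v} uv = trans (Graph.sym G v u) uv

no-loop : (G : Graph) {u v : Fin (n G)} → u ≡ v → adj G u v ≢ true
no-loop G {u} refl uu with trans (sym uu) (irrefl G u)
... | ()

∈-part : ∀ {G σ s v} → v ∈ part G σ s → σ v ≡ s
∈-part {G} {σ} {s} {v} v∈part =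
  inSide-sound s (σ v) (trans (sym (lookup∘tabulate _ v)) ([]=⇒lookup v∈part))
  where
  inSide-sound : ∀ s t → inSide s t ≡ true → t ≡ s
  inSide-sound L L _ = refl
  inSide-sound B B _ = refl
  inSide-sound R R _ = refl

rotate : Fin 4 → Fin 4
rotate zero                   = suc zero
rotate (suc zero)             = suc (suc zero)
rotate (suc (suc zero))       = suc (suc (suc zero))
rotate (suc (suc (suc zero))) = zero

rotate-unique : ∀ {i j : Fin 4} → toℕ j ≡ suc (toℕ i) ⊎ (toℕ j ≡ 0 × suc (toℕ i) ≡ 4) →
                j ≡ rotate i
rotate-unique {zero}                   (inj₁ j≡1) = toℕ-injective j≡1
rotate-unique {suc zero}               (inj₁ j≡2) = toℕ-injective j≡2
rotate-unique {suc (suc zero)}         (inj₁ j≡3) = toℕ-injective j≡3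
rotate-unique {suc (suc (suc zero))} {j} (inj₁ j≡4) = contradiction j≡4 (<⇒≢ (toℕ<n j))
rotate-unique {suc (suc (suc zero))}   (inj₂ (j≡0 , _)) = toℕ-injective j≡0

square⇒girth≤4 : (G : Graph) (a b c d : Fin (n G)) → Unique (a ∷ b ∷ c ∷ d ∷ []) →
                 adj G a b ≡ true → adj G b c ≡ true → adj G c d ≡ true → adj G d a ≡ true →
                 GirthAtMost G 4
square⇒girth≤4 G a b c d distinct ab bc cd da =
  4 , ≤-refl , s≤s (s≤s (s≤s z≤n)) , corner , injective ,
  λ i j j-follows-i → subst (λ k → adj G (corner i) (corner k) ≡ true)
                            (sym (rotate-unique j-follows-i)) (side i)
  where
  corner : Fin 4 → Fin (n G)
  corner = lookup (a ∷ b ∷ c ∷ d ∷ [])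
  injective : Injective _≡_ _≡_ corner
  injective {i} {j} = lookup-injective distinct i j
  side : ∀ i → adj G (corner i) (corner (rotate i)) ≡ true
  side zero                   = ab
  side (suc zero)             = bc
  side (suc (suc zero))       = cd
  side (suc (suc (suc zero))) = da

CommonNeighbourOutside : (G : Graph) → Subset (n G) → (x y v : Fin (n G)) → Set
CommonNeighbourOutside G C x y v = v ∉ C × adj G x v ≡ true × adj G y v ≡ true

two-or-unique-common-neighbour :
  (G : Graph) (C : Subset (n G)) (x y : Fin (n G)) →
  (∃₂ λ u w → CommonNeighbourOutside G C x y u × CommonNeighbourOutside G C x y w × u ≢ w) ⊎
  (∀ {u w} → CommonNeighbourOutside G C x y u → CommonNeighbourOutside G C x y w → u ≡ w)
two-or-unique-common-neighbour G C x y
  with any? (λ u → any? (λ w → common? u ×-dec common? w ×-dec ¬? (u ≟ w)))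
  where
  common? : ∀ v → Dec (CommonNeighbourOutside G C x y v)
  common? v = ¬? (v ∈? C) ×-dec adj G x v ≟ᵇ true ×-dec adj G y v ≟ᵇ true
... | yes two = inj₁ two
... | no ¬two = inj₂ λ {u} {w} u-common w-common →
  decidable-stable (u ≟ w) λ u≢w → ¬two (u , w , u-common , w-common , u≢w)

two-common-neighbours⇒girth≤4 :
  (G : Graph) {C : Subset (n G)} {x y u w : Fin (n G)} → x ∈ C → y ∈ C → x ≢ y →
  CommonNeighbourOutside G C x y u → CommonNeighbourOutside G C x y w → u ≢ w →
  GirthAtMost G 4
two-common-neighbours⇒girth≤4 G x∈C y∈C x≢y (u∉C , xu , yu) (w∉C , xw , yw) u≢w =
  square⇒girth≤4 G _ _ _ _
    (((λ { refl → u∉C x∈C }) ∷ x≢y ∷ (λ { refl → w∉C x∈C }) ∷ []) ∷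
     ((λ { refl → u∉C y∈C }) ∷ u≢w ∷ []) ∷
     ((λ { refl → w∉C y∈C }) ∷ []) ∷ [] ∷ [])
    xu (adj-sym G yu) yw (adj-sym G xw)

bank : {P Q : Set} → Dec P → Dec Q → Side
bank (yes _) _       = L
bank (no _)  (yes _) = R
bank (no _)  (no _)  = B

module _ {P Q : Set} where

  bank≡L⇒ : (p? : Dec P) (q? : Dec Q) → bank p? q? ≡ L → P
  bank≡L⇒ (yes p) _       _ = p
  bank≡L⇒ (no _)  (yes _) ()
  bank≡L⇒ (no _)  (no _)  ()

  bank≡L⇐ : (p? : Dec P) (q? : Dec Q) → P → bank p? q? ≡ L
  bank≡L⇐ (yes _) _ _ = refl
  bank≡L⇐ (no ¬p) _ p = contradiction p ¬p

  bank≡R⇒ : (p? : Dec P) (q? : Dec Q) → bank p? q? ≡ R → Q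
  bank≡R⇒ (yes _) _       ()
  bank≡R⇒ (no _)  (yes q) _ = q
  bank≡R⇒ (no _)  (no _)  ()

  bank≡R⇐ : (p? : Dec P) (q? : Dec Q) → ¬ P → Q → bank p? q? ≡ R
  bank≡R⇐ (yes p) _       ¬p _ = contradiction p ¬p
  bank≡R⇐ (no _)  (yes _) _  _ = refl
  bank≡R⇐ (no _)  (no ¬q) _  q = contradiction q ¬q

  bank≡B⇒ : (p? : Dec P) (q? : Dec Q) → bank p? q? ≡ B → ¬ P × ¬ Q
  bank≡B⇒ (yes _)  _        ()
  bank≡B⇒ (no _)   (yes _)  ()
  bank≡B⇒ (no ¬p)  (no ¬q)  _ = ¬p , ¬q

⌊2n/2⌋≡n : ∀ n → ⌊ 2 * n /2⌋ ≡ n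
⌊2n/2⌋≡n n = trans (cong (λ m → ⌊ n + m /2⌋) (+-identityʳ n)) (sym (n≡⌊n+n/2⌋ n))

⌈2n/2⌉≡n : ∀ n → ⌈ 2 * n /2⌉ ≡ n
⌈2n/2⌉≡n n = trans (cong (λ m → ⌈ n + m /2⌉) (+-identityʳ n)) (sym (n≡⌈n+n/2⌉ n))

-- A timetable makes the left bank a function of a counter r and the right bank a
-- function of a counter s.  The k-th triple sits at (⌊k/2⌋, ⌈k/2⌉), i.e. at (0,0),
-- (0,1), (1,1), (1,2), …, so consecutive triples alternately share the left and the
-- right bank, as the transition conditions of a schedule demand.
module Timetable (G : Graph) {OnLeft OnRight : Fin (n G) → ℕ → Set}
                 (onLeft? : ∀ v r → Dec (OnLeft v r)) (onRight? : ∀ v s → Dec (OnRight v s))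
                 where

  Trip : ℕ → ℕ → Set
  Trip r s = r ≤ s × s ≤ suc r

  Aboard : Fin (n G) → ℕ → ℕ → Set
  Aboard v r s = ¬ OnLeft v r × ¬ OnRight v s

  aboard? : ∀ v r s → Dec (Aboard v r s)
  aboard? v r s = ¬? (onLeft? v r) ×-dec ¬? (onRight? v s)

  record IsValid (M b : ℕ) : Set where
    field
      right-empty-at-start : ∀ v → ¬ OnRight v 0
      left-empty-at-end    : ∀ v → ¬ OnLeft v M
      banks-disjoint       : ∀ {v r s} → Trip r s → OnRight v s → ¬ OnLeft v r
      left-independent     : ∀ {r u v} → OnLeft u r → OnLeft v r → adj G u v ≡ false
      right-independent    : ∀ {s u v} → OnRight u s → OnRight v s → adj G u v ≡ false
      boat-capacity        : ∀ {r s} → Trip r s → (P : Subset (n G)) →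
                             (∀ {v} → v ∈ P → Aboard v r s) → ∣ P ∣ ≤ b

  position : ℕ → ℕ → Config G
  position r s v = bank (onLeft? v r) (onRight? v s)

  schedule : ℕ → Config G
  schedule k = position ⌊ k /2⌋ ⌈ k /2⌉

  trip-halves : ∀ k → Trip ⌊ k /2⌋ ⌈ k /2⌉
  trip-halves k = ⌊n/2⌋≤⌈n/2⌉ k , ⌊n/2⌋-mono (n≤1+n (suc k))

  feasible : ∀ {M b} → IsValid M b → Feasible G b
  feasible {M} {b} valid =
    M , schedule , (λ k _ → safe (trip-halves k)) , start , end , keeps-left , keeps-right
    where
    open IsValid valid

    safe : ∀ {r s} → Trip r s → IndependentSide G (position r s) L ×
           IndependentSide G (position r s) R × ∣ part G (position r s) B ∣ ≤ b
    safe {r} {s} trip =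
      (λ u v u-left v-left → left-independent (bank≡L⇒ _ _ u-left) (bank≡L⇒ _ _ v-left)) ,
      (λ u v u-right v-right → right-independent (bank≡R⇒ _ _ u-right) (bank≡R⇒ _ _ v-right)) ,
      boat-capacity trip (part G (position r s) B) (bank≡B⇒ _ _ ∘ ∈-part {G})

    left-stable : ∀ {r r′ s s′ v} → r ≡ r′ → position r s v ≡ L → position r′ s′ v ≡ L
    left-stable refl left = bank≡L⇐ _ _ (bank≡L⇒ _ _ left)

    right-stable : ∀ {r r′ s s′ v} → Trip r′ s′ → s ≡ s′ →
                   position r s v ≡ R → position r′ s′ v ≡ R
    right-stable trip refl right =
      bank≡R⇐ _ _ (banks-disjoint trip (bank≡R⇒ _ _ right)) (bank≡R⇒ _ _ right)

    even-halves : ∀ j → ⌈ 2 * j /2⌉ ≡ ⌊ 2 * j /2⌋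
    even-halves j = trans (⌈2n/2⌉≡n j) (sym (⌊2n/2⌋≡n j))

    start : ∀ v → schedule 0 v ≢ R
    start v = right-empty-at-start v ∘ bank≡R⇒ _ _

    end : ∀ v → schedule (2 * M) v ≢ L
    end v = left-empty-at-end v ∘ subst (OnLeft v) (⌊2n/2⌋≡n M) ∘ bank≡L⇒ _ _

    keeps-left : ∀ j → j < M → ∀ v →
                 (schedule (suc (2 * j)) v ≡ L → schedule (2 * j) v ≡ L) ×
                 (schedule (2 * j) v ≡ L → schedule (suc (2 * j)) v ≡ L)
    keeps-left j _ v = left-stable (even-halves j) , left-stable (sym (even-halves j))

    keeps-right : ∀ j → j < M → ∀ v →
                  (schedule (suc (suc (2 * j))) v ≡ R → schedule (suc (2 * j)) v ≡ R) ×
                  (schedule (suc (2 * j)) v ≡ R → schedule (suc (suc (2 * j))) v ≡ R)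
    keeps-right j _ v =
      right-stable (trip-halves (suc (2 * j))) (cong suc (even-halves j)) ,
      right-stable (trip-halves (suc (suc (2 * j)))) (cong suc (sym (even-halves j)))

module FerryAroundCover (G : Graph) {C : Subset (n G)} (cover : IsVertexCover G C)
  {x y : Fin (n G)} (x∈C : x ∈ C) (y∈C : y ∈ C) (x≢y : x ≢ y)
  (unique : ∀ {u w} → CommonNeighbourOutside G C x y u → CommonNeighbourOutside G C x y w →
            u ≡ w)
  where

  N : ℕ
  N = n G

  -- crossing v is the round in which v ∉ C crosses; delay is told whether v is
  -- adjacent to x and to y.
  delay : Bool → Bool → Fin N → ℕ
  delay false _     v = toℕ v
  delay true  true  v = N
  delay true  false v = N + suc (toℕ v)

  crossing : Fin N → ℕ
  crossing v = suc (delay (adj G x v) (adj G y v) v)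

  delay-bounded : ∀ a b v → delay a b v ≤ N + N
  delay-bounded false _     v = ≤-trans (<⇒≤ (toℕ<n v)) (m≤m+n N N)
  delay-bounded true  true  v = m≤m+n N N
  delay-bounded true  false v = +-monoʳ-≤ N (toℕ<n v)

  x-neighbour-delay : ∀ b v → N ≤ delay true b v
  x-neighbour-delay true  v = ≤-refl
  x-neighbour-delay false v = m≤m+n N _

  y-neighbour-delay : ∀ a v → delay a true v ≤ N
  y-neighbour-delay false v = <⇒≤ (toℕ<n v)
  y-neighbour-delay true  v = ≤-refl

  delay-injective : ∀ {a b a′ b′} {u v} → delay a b u ≡ delay a′ b′ v →
                    (a ≡ true → b ≡ true → a′ ≡ true → b′ ≡ true → u ≡ v) → u ≡ v
  delay-injective {false} {_}     {false} {_}     e _ = toℕ-injective e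
  delay-injective {false} {_}     {true}  {b′} {u} e _ =
    contradiction e (<⇒≢ (<-≤-trans (toℕ<n u) (x-neighbour-delay b′ _)))
  delay-injective {true}  {b}     {false} {_}  {_} {v} e _ =
    contradiction (sym e) (<⇒≢ (<-≤-trans (toℕ<n v) (x-neighbour-delay b _)))
  delay-injective {true}  {true}  {true}  {true}  _ both = both refl refl refl refl
  delay-injective {true}  {true}  {true}  {false} e _ = contradiction (sym e) (m+1+n≢m N)
  delay-injective {true}  {false} {true}  {true}  e _ = contradiction e (m+1+n≢m N)
  delay-injective {true}  {false} {true}  {false} e _ =
    toℕ-injective (suc-injective (+-cancelˡ-≡ N _ _ e))

  x-neighbour-crosses-late : ∀ {v} → adj G x v ≡ true → N < crossing v
  x-neighbour-crosses-late {v} xv =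
    s≤s (subst (λ a → N ≤ delay a (adj G y v) v) (sym xv) (x-neighbour-delay (adj G y v) v))

  y-neighbour-crosses-early : ∀ {v} → adj G y v ≡ true → crossing v ≤ suc N
  y-neighbour-crosses-early {v} yv =
    s≤s (subst (λ b → delay (adj G x v) b v ≤ N) (sym yv) (y-neighbour-delay (adj G x v) v))

  crossing-bounded : ∀ v → crossing v ≤ suc (N + N)
  crossing-bounded v = s≤s (delay-bounded (adj G x v) (adj G y v) v)

  crossing-injective : ∀ {u v} → u ∉ C → v ∉ C → crossing u ≡ crossing v → u ≡ v
  crossing-injective u∉C v∉C e = delay-injective (suc-injective e)
    λ xu yu xv yv → unique (u∉C , xu , yu) (v∉C , xv , yv)

  -- x waits on the right bank during the rounds 1 … N in which the non-neighbours of
  -- x cross, y on the left bank during the rounds N+1 … 2N+1 of the neighbours of x.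
  OnLeft : Fin N → ℕ → Set
  OnLeft v r = (v ≡ y × N < r × r ≤ suc (N + N)) ⊎ (v ∉ C × r < crossing v)

  OnRight : Fin N → ℕ → Set
  OnRight v s = (v ≡ x × 0 < s × s ≤ N) ⊎ (v ∉ C × crossing v < s)

  onLeft? : ∀ v r → Dec (OnLeft v r)
  onLeft? v r =
    (v ≟ y ×-dec N <? r ×-dec r ≤? suc (N + N)) ⊎-dec (¬? (v ∈? C) ×-dec r <? crossing v)

  onRight? : ∀ v s → Dec (OnRight v s)
  onRight? v s =
    (v ≟ x ×-dec 0 <? s ×-dec s ≤? N) ⊎-dec (¬? (v ∈? C) ×-dec crossing v <? s)

  open Timetable G onLeft? onRight?

  no-left-edge : ∀ {r u v} → OnLeft u r → OnLeft v r → adj G u v ≢ true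
  no-left-edge (inj₁ (refl , _))       (inj₁ (refl , _))        = no-loop G refl
  no-left-edge (inj₁ (refl , N<r , _)) (inj₂ (_ , r<crossing)) yv =
    <⇒≱ r<crossing (≤-trans (y-neighbour-crosses-early yv) N<r)
  no-left-edge (inj₂ (_ , r<crossing)) (inj₁ (refl , N<r , _)) uy =
    <⇒≱ r<crossing (≤-trans (y-neighbour-crosses-early (adj-sym G uy)) N<r)
  no-left-edge (inj₂ (u∉C , _))        (inj₂ (v∉C , _))        uv = [ u∉C , v∉C ]′ (cover _ _ uv)

  no-right-edge : ∀ {s u v} → OnRight u s → OnRight v s → adj G u v ≢ true
  no-right-edge (inj₁ (refl , _))        (inj₁ (refl , _))        = no-loop G refl
  no-right-edge (inj₁ (refl , _ , s≤N))  (inj₂ (_ , crossing<s)) xv =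
    <⇒≱ (x-neighbour-crosses-late xv) (≤-trans (<⇒≤ crossing<s) s≤N)
  no-right-edge (inj₂ (_ , crossing<s)) (inj₁ (refl , _ , s≤N))  ux =
    <⇒≱ (x-neighbour-crosses-late (adj-sym G ux)) (≤-trans (<⇒≤ crossing<s) s≤N)
  no-right-edge (inj₂ (u∉C , _))         (inj₂ (v∉C , _))        uv = [ u∉C , v∉C ]′ (cover _ _ uv)

  banks-disjoint : ∀ {v r s} → Trip r s → OnRight v s → ¬ OnLeft v r
  banks-disjoint _ (inj₁ (refl , _)) (inj₁ (x≡y , _)) = x≢y x≡y
  banks-disjoint _ (inj₁ (refl , _)) (inj₂ (x∉C , _)) = x∉C x∈C
  banks-disjoint _ (inj₂ (v∉C , _)) (inj₁ (refl , _)) = v∉C y∈C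
  banks-disjoint (_ , s≤1+r) (inj₂ (_ , crossing<s)) (inj₂ (_ , r<crossing)) =
    <⇒≱ crossing<s (≤-trans s≤1+r r<crossing)

  ferried-now : ∀ {v r s} → v ∉ C → Trip r s → Aboard v r s → crossing v ≡ r × r ≡ s
  ferried-now v∉C (r≤s , _) (not-left , not-right) =
    ≤-antisym crossing≤r (≤-trans r≤s s≤crossing) , ≤-antisym r≤s (≤-trans s≤crossing crossing≤r)
    where
    crossing≤r = ≮⇒≥ (not-left ∘ inj₂ ∘ (v∉C ,_))
    s≤crossing = ≮⇒≥ (not-right ∘ inj₂ ∘ (v∉C ,_))

  x-or-y-ashore : ∀ {w r s} → w ∉ C → Trip r s → Aboard w r s → ∃ λ z → z ∈ C × ¬ Aboard z r s
  x-or-y-ashore {w} w∉C trip aboard with ferried-now w∉C trip aboard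
  ... | refl , refl with crossing w ≤? N
  ...   | yes crossing≤N = x , x∈C , λ (_ , not-right) →
                             not-right (inj₁ (refl , s≤s z≤n , crossing≤N))
  ...   | no crossing≰N  = y , y∈C , λ (not-left , _) →
                             not-left (inj₁ (refl , ≰⇒> crossing≰N , crossing-bounded w))

  boat-capacity : ∀ {r s} → Trip r s → (P : Subset N) → (∀ {v} → v ∈ P → Aboard v r s) →
                  ∣ P ∣ ≤ ∣ C ∣
  boat-capacity {r} {s} trip P aboard with any? (λ w → ¬? (w ∈? C) ×-dec aboard? w r s)
  ... | no none = p⊆q⇒∣p∣≤∣q∣ λ {v} v∈P →
                    decidable-stable (v ∈? C) λ v∉C → none (v , v∉C , aboard v∈P)
  ... | yes (w , w∉C , w-aboard) with x-or-y-ashore w∉C trip w-aboard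
  ...   | z , z∈C , z-ashore = ∣p∣≤∣q∣-by-exchange z∈C exchange
    where
    exchange : ∀ {v} → v ∈ P → v ≢ w → v ∈ C × v ≢ z
    exchange {v} v∈P v≢w =
      decidable-stable (v ∈? C) (λ v∉C → v≢w (crossing-injective v∉C w∉C
        (trans (proj₁ (ferried-now v∉C trip (aboard v∈P)))
               (sym (proj₁ (ferried-now w∉C trip w-aboard)))))) ,
      λ { refl → z-ashore (aboard v∈P) }

  valid : IsValid (suc (suc (N + N))) ∣ C ∣
  valid = record
    { right-empty-at-start = λ { _ (inj₁ (_ , () , _)) ; _ (inj₂ (_ , ())) }
    ; left-empty-at-end    = λ { _ (inj₁ (_ , _ , M≤2N+1)) → 1+n≰n M≤2N+1
                               ; v (inj₂ (_ , M<crossing)) →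
                                   <⇒≱ M<crossing (≤-trans (crossing-bounded v) (n≤1+n _)) }
    ; banks-disjoint       = banks-disjoint
    ; left-independent     = λ u-left v-left → ¬-not (no-left-edge u-left v-left)
    ; right-independent    = λ u-right v-right → ¬-not (no-right-edge u-right v-right)
    ; boat-capacity        = boat-capacity
    }

  feasible-with-cover : Feasible G ∣ C ∣
  feasible-with-cover = feasible valid

class-two⇒infeasible : ∀ {G β} → ClassTwo G → IsVertexCoverNumber G β → 1 ≤ β → ¬ Feasible G β
class-two⇒infeasible (_ , ((C′ , cover′ , ∣C′∣≡β′) , _) , (_ , _ , least)) (_ , minimal) 1≤β
                     feasible =
  <⇒≱ (least _ 1≤β feasible) (subst (_ ≤_) ∣C′∣≡β′ (minimal C′ cover′))

corollary3p3 : (G : Graph) → ClassTwo G → (β : ℕ) → IsVertexCoverNumber G β →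
    2 ≤ β → GirthAtMost G 4
corollary3p3 G class-two β β-is-cover-number@((C , cover , ∣C∣≡β) , _) 2≤β
  with two-members C (subst (2 ≤_) (sym ∣C∣≡β) 2≤β)
... | x , y , x∈C , y∈C , x≢y with two-or-unique-common-neighbour G C x y
... | inj₁ (u , w , u-common , w-common , u≢w) =
  two-common-neighbours⇒girth≤4 G x∈C y∈C x≢y u-common w-common u≢w
... | inj₂ unique =
  contradiction (subst (Feasible G) ∣C∣≡β feasible)
                (class-two⇒infeasible {G} class-two β-is-cover-number (≤-trans (s≤s z≤n) 2≤β))
  where
  feasible : Feasible G ∣ C ∣
  feasible = FerryAroundCover.feasible-with-cover G cover x∈C y∈C x≢y unique
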